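{- Let $\mathbb{F}$ be a field and $n\ge 2$. Then the partition rank of $\det_n$, viewed as an $n$-linear form $(\mathbb{F}^n)^n\to\mathbb{F}$ in the rows of the matrix, satisfies $\mathrm{prk}(\det_n)\ge \log_2(n)+1$.
   Context: For a $d$-linear form $T\colon(\mathbb{F}^n)^d\to\mathbb{F}$ in vector variables $x^{(1)},\dots,x^{(d)}$, the partition rank $\mathrm{prk}(T)$ is the least $r$ such that $T=\sum_{i=1}^r Q_iR_i$, where for each $i$ there is a nonempty proper subset $I_i\subsetneq[d]$ such that $Q_i$ is a multilinear form in the variables $x^{(j)}$, $j\in I_i$, and $R_i$ is a multilinear form in the variables $x^{(j)}$, $j\notin I_i$. -}

module Defs where

open import Level using (_⊔_)
open import Algebra.Bundles using (CommutativeRing)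
open import Data.Nat as ℕ using (ℕ; zero; suc)
open import Data.Fin using (Fin; zero; suc; punchIn; toℕ; _≟_)
open import Data.Fin.Subset using (Subset; _∈_; ∁; Nonempty)
open import Data.Product using (Σ; _×_)
open import Relation.Nullary using (¬_; yes; no)

record Field (c ℓ : Level.Level) : Set (Level.suc (c ⊔ ℓ)) where
  field
    commutativeRing : CommutativeRing c ℓ
  open CommutativeRing commutativeRing public
  field
    0≉1     : ¬ (0# ≈ 1#)
    inverse : ∀ x → ¬ (x ≈ 0#) → Σ Carrier (λ y → x * y ≈ 1#)

module _ {c ℓ} (F : Field c ℓ) where
  open Field F using (Carrier; _≈_; _+_; _*_; -_; 0#; 1#)

  Vector : ℕ → Set c
  Vector n = Fin n → Carrier

  Form : ℕ → ℕ → Set c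
  Form d n = (Fin d → Vector n) → Carrier

  update : ∀ {d n} → (Fin d → Vector n) → Fin d → Vector n → (Fin d → Vector n)
  update xs j u i with i ≟ j
  ... | yes _ = u
  ... | no  _ = xs i

  MultilinearIn : ∀ {d n} → Subset d → Form d n → Set (c ⊔ ℓ)
  MultilinearIn {d} {n} I f =
      (∀ xs ys → (∀ j → j ∈ I → ∀ k → xs j k ≈ ys j k) → f xs ≈ f ys)
    × (∀ j → j ∈ I → ∀ xs (u v : Vector n) →
         f (update xs j (λ k → u k + v k)) ≈ f (update xs j u) + f (update xs j v))
    × (∀ j → j ∈ I → ∀ xs (a : Carrier) (u : Vector n) →
         f (update xs j (λ k → a * u k)) ≈ a * f (update xs j u))

  ∑ : ∀ {r} → (Fin r → Carrier) → Carrier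
  ∑ {zero}  g = 0#
  ∑ {suc r} g = g zero + ∑ (λ i → g (suc i))

  PartitionRankDecomposition : ∀ {d n} → ℕ → Form d n → Set (c ⊔ ℓ)
  PartitionRankDecomposition {d} {n} r T =
    Σ (Fin r → Subset d) λ I →
    Σ (Fin r → Form d n) λ Q →
    Σ (Fin r → Form d n) λ R →
        (∀ i → Nonempty (I i) × Nonempty (∁ (I i)))
      × (∀ i → MultilinearIn (I i) (Q i))
      × (∀ i → MultilinearIn (∁ (I i)) (R i))
      × (∀ xs → T xs ≈ ∑ (λ i → Q i xs * R i xs))

  PrkAtLeast : ∀ {d n} → ℕ → Form d n → Set (c ⊔ ℓ)
  PrkAtLeast m T = ∀ r → PartitionRankDecomposition r T → m ℕ.≤ r

  signed : ℕ → Carrier → Carrier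
  signed zero          a = a
  signed (suc zero)    a = - a
  signed (suc (suc k)) a = signed k a

  det : (n : ℕ) → (Fin n → Vector n) → Carrier
  det zero    M = 1#
  det (suc n) M = ∑ (λ j → signed (toℕ j) (M zero j * det n (λ i k → M (suc i) (punchIn j k))))

  detForm : (n : ℕ) → Form n n
  detForm n xs = det n xs

{-# OPTIONS --safe #-}
module Submission where

-- Only two properties of det_n are used: it is alternating and multilinear in the rows, and it is
-- nonzero at the identity.  Fix a decomposition T = ∑ᵢ Qᵢ Rᵢ, Qᵢ depending on the rows in Iᵢ and Rᵢ on
-- the others.  A set J of rows is admissible for a set L of terms at a matrix w if, on the slice of
-- matrices agreeing with w outside J, T is not identically zero, each term whose Iᵢ is not split by J
-- vanishes identically, and every split term lies in L.  Pick i₀ ∈ L and let J′ be the larger of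
-- J ∩ I_{i₀} and J ∖ I_{i₀}.  If |L| ≤ |J′|, the rows of J ∖ J′ can be frozen one at a time: freezing
-- row k imposes |L| < |J| homogeneous linear conditions (the factor containing row k of each term of L
-- must vanish), and since T is alternating a nontrivial solution keeps T nonzero.  Afterwards J′ no
-- longer splits I_{i₀}, so i₀ leaves L.  By induction 2|J| ≤ 2^|L| (immediate when |J′| < |L|); for all
-- n rows and all r terms this is 2n ≤ 2^r.  Choosing pivots in the linear algebra needs to decide
-- whether field elements vanish, so those steps are proved under double negation, which the decidable
-- conclusion absorbs.

open import Defs
open import Level using (Level; _⊔_)
open import Data.Nat as ℕ using (ℕ; zero; suc; _≤_; _<_; _^_; z≤n; s≤s; NonZero)
open import Data.Nat.Properties using (≤-trans; ≤-<-trans; <-trans; ≤-pred; n<1+n; _≤?_; ≰⇒>; +-mono-≤)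
open import Data.Fin using (Fin; zero; suc; _≟_; punchIn; toℕ; lift)
open import Data.Fin.Properties using (punchInᵢ≢i; suc-injective)
open import Data.Fin.Subset using (Subset; inside; outside; _∈_; _∉_; _⊆_; _⊂_; _∩_; ∁; _-_; ∣_∣; Nonempty; ⊤)
open import Data.Fin.Subset.Properties
  using ( _∈?_; nonempty?; ∈⊤; ∣⊤∣≡n; x∈p∩q⁺; x∈p∩q⁻; x∈∁p⇒x∉p; x∈p⇒x∉∁p; x∉p⇒x∈∁p; p∩q⊆p; p─q⊆p
        ; x∈p∧x≢y⇒x∈p-y; x∈p⇒p-x⊂p; p⊂q⇒∣p∣<∣q∣; ⊆-antisym; Empty-unique; ∣⊥∣≡0; p─⊥≡p)
open import Data.Fin.Subset.Induction using (Acc; acc; ⊂-wellFounded)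
open import Data.Vec using ([]; _∷_; here; there)
open import Data.Product using (Σ; ∃; _×_; _,_; proj₁; proj₂)
open import Data.Sum using (_⊎_; inj₁; inj₂)
open import Function using (_∘_)
open import Relation.Nullary using (¬_; Dec; yes; no; _×-dec_; contradiction; ¬¬-map)
open import Relation.Nullary.Decidable using (decidable-stable)
open import Relation.Binary.PropositionalEquality as ≡ using (_≡_; _≢_; subst; subst₂)
import Algebra.Properties.Ring as RingProperties
import Algebra.Properties.CommutativeSemigroup as CommutativeSemigroupProperties
import Algebra.Properties.Semiring.Sum as SemiringSum
import Relation.Binary.Reasoning.Setoid as SetoidReasoning

module DoubleNegation where
  -- Unlike the library's ¬¬-Monad, this bind may change universe level.
  _>>=_ : ∀ {a b} {A : Set a} {B : Set b} → ¬ ¬ A → (A → ¬ ¬ B) → ¬ ¬ B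
  (¬¬a >>= f) ¬b = ¬¬a (λ a → f a ¬b)

  ¬¬-Π-Fin : ∀ {p d} {P : Fin d → Set p} → (∀ j → ¬ ¬ P j) → ¬ ¬ (∀ j → P j)
  ¬¬-Π-Fin {d = zero}  h k = k λ ()
  ¬¬-Π-Fin {d = suc d} h k =
    h zero λ p₀ → ¬¬-Π-Fin (h ∘ suc) λ ps → k λ { zero → p₀ ; (suc j) → ps j }

module Subsets where
  open import Data.Nat using (_+_)
  open import Data.Nat.Properties using (≤-total; +-monoʳ-≤; +-monoˡ-≤; +-suc)

  x∈p⇒∣p∣≡suc∣p-x∣ : ∀ {n} {p : Subset n} {x} → x ∈ p → ∣ p ∣ ≡ suc ∣ p - x ∣
  x∈p⇒∣p∣≡suc∣p-x∣ {p = inside  ∷ p} here        = ≡.cong (suc ∘ ∣_∣) (≡.sym (p─⊥≡p p))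
  x∈p⇒∣p∣≡suc∣p-x∣ {p = inside  ∷ p} (there x∈p) = ≡.cong suc (x∈p⇒∣p∣≡suc∣p-x∣ x∈p)
  x∈p⇒∣p∣≡suc∣p-x∣ {p = outside ∷ p} (there x∈p) = x∈p⇒∣p∣≡suc∣p-x∣ x∈p

  ∣p∣≡∣p∩q∣+∣p∩∁q∣ : ∀ {n} (p q : Subset n) → ∣ p ∣ ≡ ∣ p ∩ q ∣ + ∣ p ∩ ∁ q ∣
  ∣p∣≡∣p∩q∣+∣p∩∁q∣ []            []            = ≡.refl
  ∣p∣≡∣p∩q∣+∣p∩∁q∣ (outside ∷ p) (_       ∷ q) = ∣p∣≡∣p∩q∣+∣p∩∁q∣ p q
  ∣p∣≡∣p∩q∣+∣p∩∁q∣ (inside  ∷ p) (inside  ∷ q) = ≡.cong suc (∣p∣≡∣p∩q∣+∣p∩∁q∣ p q)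
  ∣p∣≡∣p∩q∣+∣p∩∁q∣ (inside  ∷ p) (outside ∷ q) =
    ≡.trans (≡.cong suc (∣p∣≡∣p∩q∣+∣p∩∁q∣ p q)) (≡.sym (+-suc ∣ p ∩ q ∣ ∣ p ∩ ∁ q ∣))

  0<∣p∣⇒Nonempty : ∀ {n} {p : Subset n} → 0 < ∣ p ∣ → Nonempty p
  0<∣p∣⇒Nonempty {n} {p} 0<∣p∣ with nonempty? p
  ... | yes p≢∅ = p≢∅
  ... | no  p≡∅ = contradiction (subst (0 <_) ∣p∣≡0 0<∣p∣) λ ()
    where
      ∣p∣≡0 : ∣ p ∣ ≡ 0
      ∣p∣≡0 = ≡.trans (≡.cong ∣_∣ (Empty-unique p≡∅)) (∣⊥∣≡0 n)

  x∉p-x : ∀ {n} {p : Subset n} x → x ∉ p - x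
  x∉p-x {p = _ ∷ p} zero    ()
  x∉p-x {p = _ ∷ p} (suc x) (there x∈p-x) = x∉p-x x x∈p-x

  Empty-∩∁⇒⊆ : ∀ {n} {p q : Subset n} → ¬ Nonempty (p ∩ ∁ q) → p ⊆ q
  Empty-∩∁⇒⊆ {q = q} p∩∁q≡∅ {x} x∈p with x ∈? q
  ... | yes x∈q = x∈q
  ... | no  x∉q = contradiction (x , x∈p∩q⁺ (x∈p , x∉p⇒x∈∁p x∉q)) p∩∁q≡∅

  module _ {d : ℕ} where
    Splits : Subset d → Subset d → Set
    Splits J A = Nonempty (J ∩ A) × Nonempty (J ∩ ∁ A)

    splits? : ∀ J A → Dec (Splits J A)
    splits? J A = nonempty? (J ∩ A) ×-dec nonempty? (J ∩ ∁ A)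

    Splits-⊤ : ∀ {A : Subset d} → Nonempty A → Nonempty (∁ A) → Splits ⊤ A
    Splits-⊤ (j , j∈A) (j′ , j′∈∁A) = (j , x∈p∩q⁺ (∈⊤ , j∈A)) , (j′ , x∈p∩q⁺ (∈⊤ , j′∈∁A))

    Splits-mono : ∀ {J J′ A : Subset d} → J′ ⊆ J → Splits J′ A → Splits J A
    Splits-mono {J} {J′} {A} J′⊆J ((j , j∈J′∩A) , (j′ , j′∈J′∩∁A)) =
      (j , grow A j∈J′∩A) , (j′ , grow (∁ A) j′∈J′∩∁A)
      where
        grow : ∀ B {x} → x ∈ J′ ∩ B → x ∈ J ∩ B
        grow B x∈J′∩B with x∈p∩q⁻ J′ B x∈J′∩B
        ... | x∈J′ , x∈B = x∈p∩q⁺ (J′⊆J x∈J′ , x∈B)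

    Nonempty-∩-remove : ∀ {J A : Subset d} {k} → k ∉ A → Nonempty (J ∩ A) → Nonempty ((J - k) ∩ A)
    Nonempty-∩-remove {J} {A} k∉A (j , j∈J∩A) with x∈p∩q⁻ J A j∈J∩A
    ... | j∈J , j∈A = j , x∈p∩q⁺ (x∈p∧x≢y⇒x∈p-y j∈J (λ { ≡.refl → k∉A j∈A }) , j∈A)

    J∩A-unsplit : ∀ J A → ¬ Splits (J ∩ A) A
    J∩A-unsplit J A (_ , j , j∈J∩A∩∁A) with x∈p∩q⁻ (J ∩ A) (∁ A) j∈J∩A∩∁A
    ... | j∈J∩A , j∈∁A = x∈∁p⇒x∉p j∈∁A (proj₂ (x∈p∩q⁻ J A j∈J∩A))

    J∩∁A-unsplit : ∀ J A → ¬ Splits (J ∩ ∁ A) A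
    J∩∁A-unsplit J A ((j , j∈J∩∁A∩A) , _) with x∈p∩q⁻ (J ∩ ∁ A) A j∈J∩∁A∩A
    ... | j∈J∩∁A , j∈A = x∈∁p⇒x∉p (proj₂ (x∈p∩q⁻ J (∁ A) j∈J∩∁A)) j∈A

    larger-unsplit-part : ∀ (J A : Subset d) →
                          ∃ λ J′ → J′ ⊆ J × ¬ Splits J′ A × ∣ J ∣ ≤ ∣ J′ ∣ + ∣ J′ ∣
    larger-unsplit-part J A with ≤-total ∣ J ∩ ∁ A ∣ ∣ J ∩ A ∣
    ... | inj₁ ∁A≤A = J ∩ A , p∩q⊆p J A , J∩A-unsplit J A
                    , subst (_≤ ∣ J ∩ A ∣ + ∣ J ∩ A ∣) ∣J∣≡ (+-monoʳ-≤ ∣ J ∩ A ∣ ∁A≤A)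
      where ∣J∣≡ = ≡.sym (∣p∣≡∣p∩q∣+∣p∩∁q∣ J A)
    ... | inj₂ A≤∁A = J ∩ ∁ A , p∩q⊆p J (∁ A) , J∩∁A-unsplit J A
                    , subst (_≤ ∣ J ∩ ∁ A ∣ + ∣ J ∩ ∁ A ∣) ∣J∣≡ (+-monoˡ-≤ ∣ J ∩ ∁ A ∣ A≤∁A)
      where ∣J∣≡ = ≡.sym (∣p∣≡∣p∩q∣+∣p∩∁q∣ J A)

module Arithmetic where
  open import Data.Nat using (_+_; _*_)
  open import Data.Nat.Properties using (≤-refl; +-suc; +-comm; +-identityʳ; ^-monoʳ-≤; module ≤-Reasoning)
  open import Data.Nat.Logarithm using (⌈log₂_⌉; ⌈log₂⌉-mono-≤; ⌈log₂2*n⌉≡1+⌈log₂n⌉; ⌈log₂2^n⌉≡n)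

  m+m≤2^m : ∀ m → m + m ≤ 2 ^ m
  m+m≤2^m zero          = z≤n
  m+m≤2^m (suc zero)    = ≤-refl
  m+m≤2^m (suc (suc m)) = begin
    suc (suc m) + suc (suc m) ≡⟨ ≡.cong suc (+-suc (suc m) (suc m)) ⟩
    2 + (suc m + suc m)       ≤⟨ +-mono-≤ (^-monoʳ-≤ 2 {1} {suc m} (s≤s z≤n)) (m+m≤2^m (suc m)) ⟩
    2 ^ suc m + 2 ^ suc m     ≡⟨ ≡.cong (2 ^ suc m +_) (≡.sym (+-identityʳ (2 ^ suc m))) ⟩
    2 ^ suc (suc m)           ∎
    where open ≤-Reasoning

  doubling-bound : ∀ {x a m} → x ≤ a + a → a + a ≤ 2 ^ m → x + x ≤ 2 ^ suc m
  doubling-bound {x} {a} {m} x≤2a 2a≤2^m = begin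
    x + x              ≤⟨ +-mono-≤ x≤2a x≤2a ⟩
    (a + a) + (a + a)  ≤⟨ +-mono-≤ 2a≤2^m 2a≤2^m ⟩
    2 ^ m + 2 ^ m      ≡⟨ ≡.cong (2 ^ m +_) (≡.sym (+-identityʳ (2 ^ m))) ⟩
    2 ^ suc m          ∎
    where open ≤-Reasoning

  ⌈log₂⌉-bound : ∀ n r .{{_ : NonZero n}} → n + n ≤ 2 ^ r → ⌈log₂ n ⌉ + 1 ≤ r
  ⌈log₂⌉-bound n r n+n≤2^r = begin
    ⌈log₂ n ⌉ + 1    ≡⟨ +-comm ⌈log₂ n ⌉ 1 ⟩
    1 + ⌈log₂ n ⌉    ≡⟨ ⌈log₂2*n⌉≡1+⌈log₂n⌉ n ⟨
    ⌈log₂ (2 * n) ⌉  ≤⟨ ⌈log₂⌉-mono-≤ 2n≤2^r ⟩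
    ⌈log₂ (2 ^ r) ⌉  ≡⟨ ⌈log₂2^n⌉≡n r ⟩
    r                ∎
    where
      open ≤-Reasoning
      2n≤2^r : 2 * n ≤ 2 ^ r
      2n≤2^r = subst (_≤ 2 ^ r) (≡.cong (n +_) (≡.sym (+-identityʳ n))) n+n≤2^r

open Subsets
open Arithmetic

module FieldAlgebra {c ℓ} (F : Field c ℓ) where
  open Field F public hiding (zero; _-_)
  open RingProperties ring public
    using (-‿involutive; -0#≈0#; -‿distribˡ-*; -‿distribʳ-*; -‿+-comm; +-inverseˡ-unique)
  open SetoidReasoning setoid public
  open CommutativeSemigroupProperties *-commutativeSemigroup public using (x∙yz≈y∙xz)
  private module S = SemiringSum semiring

  ∑≡sum : ∀ {r} (f : Fin r → Carrier) → ∑ F f ≡ S.sum f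
  ∑≡sum {zero}  f = ≡.refl
  ∑≡sum {suc r} f = ≡.cong (f zero +_) (∑≡sum (f ∘ suc))

  ∑-cong : ∀ {r} {f g : Fin r → Carrier} → (∀ i → f i ≈ g i) → ∑ F f ≈ ∑ F g
  ∑-cong {f = f} {g} f≈g = begin
    ∑ F f   ≡⟨ ∑≡sum f ⟩
    S.sum f ≈⟨ S.sum-cong-≋ f≈g ⟩
    S.sum g ≡⟨ ∑≡sum g ⟨
    ∑ F g   ∎

  ∑-zero : ∀ {r} {f : Fin r → Carrier} → (∀ i → f i ≈ 0#) → ∑ F f ≈ 0#
  ∑-zero {r} {f} f≈0 = begin
    ∑ F f                ≈⟨ ∑-cong f≈0 ⟩
    ∑ F {r} (λ _ → 0#)   ≡⟨ ∑≡sum {r} (λ _ → 0#) ⟩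
    S.sum {r} (λ _ → 0#) ≈⟨ S.sum-replicate-zero r ⟩
    0#                   ∎

  ∑-distrib-+ : ∀ {r} (f g : Fin r → Carrier) → ∑ F (λ i → f i + g i) ≈ ∑ F f + ∑ F g
  ∑-distrib-+ {r} f g = begin
    ∑ F (λ i → f i + g i)       ≡⟨ ∑≡sum (λ i → f i + g i) ⟩
    S.sum {r} (λ i → f i + g i) ≈⟨ S.∑-distrib-+ f g ⟩
    S.sum f + S.sum g           ≡⟨ ≡.cong₂ _+_ (∑≡sum f) (∑≡sum g) ⟨
    ∑ F f + ∑ F g               ∎

  *-distribˡ-∑ : ∀ {r} a (f : Fin r → Carrier) → a * ∑ F f ≈ ∑ F (λ i → a * f i)
  *-distribˡ-∑ {r} a f = begin
    a * ∑ F f                 ≡⟨ ≡.cong (a *_) (∑≡sum f) ⟩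
    a * S.sum f               ≈⟨ S.*-distribˡ-sum a f ⟩
    S.sum {r} (λ i → a * f i) ≡⟨ ∑≡sum (λ i → a * f i) ⟨
    ∑ F (λ i → a * f i)       ∎

  -‿distrib-∑ : ∀ {r} (f : Fin r → Carrier) → - ∑ F f ≈ ∑ F (λ i → - f i)
  -‿distrib-∑ {zero}  f = -0#≈0#
  -‿distrib-∑ {suc r} f = trans (sym (-‿+-comm _ _)) (+-congˡ (-‿distrib-∑ (f ∘ suc)))

  ∑-single : ∀ {r} (f : Fin r → Carrier) k → (∀ j → j ≢ k → f j ≈ 0#) → ∑ F f ≈ f k
  ∑-single {suc r} f k others≈0 = begin
    ∑ F f                           ≡⟨ ∑≡sum f ⟩
    S.sum f                         ≈⟨ S.sum-remove f ⟩
    f k + S.sum {r} (f ∘ punchIn k) ≡⟨ ≡.cong (f k +_) (∑≡sum (f ∘ punchIn k)) ⟨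
    f k + ∑ F (f ∘ punchIn k)       ≈⟨ +-congˡ (∑-zero (λ j → others≈0 _ (punchInᵢ≢i k j))) ⟩
    f k + 0#                        ≈⟨ +-identityʳ (f k) ⟩
    f k                             ∎

  signed-cong : ∀ k {a b} → a ≈ b → signed F k a ≈ signed F k b
  signed-cong zero          a≈b = a≈b
  signed-cong (suc zero)    a≈b = -‿cong a≈b
  signed-cong (suc (suc k)) a≈b = signed-cong k a≈b

  signed-suc : ∀ k a → signed F (suc k) a ≈ - signed F k a
  signed-suc zero          a = refl
  signed-suc (suc zero)    a = sym (-‿involutive a)
  signed-suc (suc (suc k)) a = signed-suc k a

  signed-‿ : ∀ k a → signed F k (- a) ≈ - signed F k a
  signed-‿ zero          a = refl
  signed-‿ (suc zero)    a = refl
  signed-‿ (suc (suc k)) a = signed-‿ k a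

  signed-suc-‿ : ∀ k a → signed F (suc k) (- a) ≈ signed F k a
  signed-suc-‿ k a = trans (signed-suc k (- a)) (trans (-‿cong (signed-‿ k a)) (-‿involutive _))

  signed-+ : ∀ k a b → signed F k (a + b) ≈ signed F k a + signed F k b
  signed-+ zero          a b = refl
  signed-+ (suc zero)    a b = sym (-‿+-comm a b)
  signed-+ (suc (suc k)) a b = signed-+ k a b

  signed-*ˡ : ∀ k a b → signed F k (a * b) ≈ a * signed F k b
  signed-*ˡ zero          a b = refl
  signed-*ˡ (suc zero)    a b = -‿distribʳ-* a b
  signed-*ˡ (suc (suc k)) a b = signed-*ˡ k a b

  signed-vanishes : ∀ k {a} → a ≈ 0# → signed F k a ≈ 0#
  signed-vanishes zero          a≈0 = a≈0
  signed-vanishes (suc zero)    a≈0 = trans (-‿cong a≈0) -0#≈0#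
  signed-vanishes (suc (suc k)) a≈0 = signed-vanishes k a≈0

  δ : ∀ {d} → Fin d → Fin d → Carrier
  δ zero    zero    = 1#
  δ zero    (suc _) = 0#
  δ (suc _) zero    = 0#
  δ (suc i) (suc j) = δ i j

  δ-diagonal : ∀ {d} (i : Fin d) → δ i i ≈ 1#
  δ-diagonal zero    = refl
  δ-diagonal (suc i) = δ-diagonal i

  δ-off-diagonal : ∀ {d} {i j : Fin d} → j ≢ i → δ i j ≈ 0#
  δ-off-diagonal {i = zero}  {zero}  j≢i = contradiction ≡.refl j≢i
  δ-off-diagonal {i = zero}  {suc j} _   = refl
  δ-off-diagonal {i = suc i} {zero}  _   = refl
  δ-off-diagonal {i = suc i} {suc j} j≢i = δ-off-diagonal (j≢i ∘ ≡.cong suc)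

  *-nonzero : ∀ {a b} → ¬ a ≈ 0# → ¬ b ≈ 0# → ¬ a * b ≈ 0#
  *-nonzero {a} {b} a≉0 b≉0 ab≈0 with inverse a a≉0
  ... | a⁻¹ , aa⁻¹≈1 = b≉0 (begin
    b              ≈⟨ *-identityˡ b ⟨
    1# * b         ≈⟨ *-congʳ aa⁻¹≈1 ⟨
    (a * a⁻¹) * b  ≈⟨ *-congʳ (*-comm a a⁻¹) ⟩
    (a⁻¹ * a) * b  ≈⟨ *-assoc a⁻¹ a b ⟩
    a⁻¹ * (a * b)  ≈⟨ *-congˡ ab≈0 ⟩
    a⁻¹ * 0#       ≈⟨ zeroʳ a⁻¹ ⟩
    0#             ∎)

  -‿nonzero : ∀ {a} → ¬ a ≈ 0# → ¬ - a ≈ 0#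
  -‿nonzero {a} a≉0 -a≈0 = a≉0 (begin
    a      ≈⟨ -‿involutive a ⟨
    - - a  ≈⟨ -‿cong -a≈0 ⟩
    - 0#   ≈⟨ -0#≈0# ⟩
    0#     ∎)

module Forms {c ℓ} (F : Field c ℓ) where
  open FieldAlgebra F

  record Linear {N} (f : Vector F N → Carrier) : Set (c ⊔ ℓ) where
    field
      cong   : ∀ {u v} → (∀ k → u k ≈ v k) → f u ≈ f v
      +-homo : ∀ u v → f (λ k → u k + v k) ≈ f u + f v
      *-homo : ∀ a u → f (λ k → a * u k) ≈ a * f u

  module _ {N : ℕ} where
    linear-0# : ∀ {f : Vector F N → Carrier} → Linear f → f (λ _ → 0#) ≈ 0#
    linear-0# {f} lin = begin
      f (λ _ → 0#)       ≈⟨ Linear.cong lin (λ _ → zeroˡ 0#) ⟨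
      f (λ _ → 0# * 0#)  ≈⟨ Linear.*-homo lin 0# (λ _ → 0#) ⟩
      0# * f (λ _ → 0#)  ≈⟨ zeroˡ _ ⟩
      0#                 ∎

    linear-combination : ∀ {f : Vector F N → Carrier} → Linear f →
      ∀ {s} (a : Fin s → Carrier) (u : Fin s → Vector F N) →
      f (λ k → ∑ F (λ j → a j * u j k)) ≈ ∑ F (λ j → a j * f (u j))
    linear-combination lin {zero}  a u = linear-0# lin
    linear-combination {f} lin {suc s} a u = begin
      f (λ k → a zero * u zero k + ∑ F (λ j → a (suc j) * u (suc j) k))
        ≈⟨ Linear.+-homo lin _ _ ⟩
      f (λ k → a zero * u zero k) + f (λ k → ∑ F (λ j → a (suc j) * u (suc j) k))
        ≈⟨ +-cong (Linear.*-homo lin _ _) (linear-combination lin (a ∘ suc) (u ∘ suc)) ⟩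
      a zero * f (u zero) + ∑ F (λ j → a (suc j) * f (u (suc j)))
        ∎

    linear-cong : ∀ {f g : Vector F N → Carrier} → (∀ u → f u ≈ g u) → Linear f → Linear g
    linear-cong f≈g lin = record
      { cong   = λ u≈v → trans (sym (f≈g _)) (trans (Linear.cong lin u≈v) (f≈g _))
      ; +-homo = λ u v → trans (sym (f≈g _)) (trans (Linear.+-homo lin u v) (+-cong (f≈g u) (f≈g v)))
      ; *-homo = λ a u → trans (sym (f≈g _)) (trans (Linear.*-homo lin a u) (*-congˡ (f≈g u)))
      }

    linear-coordinate : ∀ k → Linear {N} (λ u → u k)
    linear-coordinate k = record { cong = λ u≈v → u≈v k ; +-homo = λ _ _ → refl ; *-homo = λ _ _ → refl }

    linear-*ʳ : ∀ {f : Vector F N → Carrier} → Linear f → ∀ b → Linear (λ u → f u * b)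
    linear-*ʳ lin b = record
      { cong   = λ u≈v → *-congʳ (Linear.cong lin u≈v)
      ; +-homo = λ u v → trans (*-congʳ (Linear.+-homo lin u v)) (distribʳ b _ _)
      ; *-homo = λ a u → trans (*-congʳ (Linear.*-homo lin a u)) (*-assoc a _ b)
      }

    linear-*ˡ : ∀ b {f : Vector F N → Carrier} → Linear f → Linear (λ u → b * f u)
    linear-*ˡ b lin = record
      { cong   = λ u≈v → *-congˡ (Linear.cong lin u≈v)
      ; +-homo = λ u v → trans (*-congˡ (Linear.+-homo lin u v)) (distribˡ b _ _)
      ; *-homo = λ a u → trans (*-congˡ (Linear.*-homo lin a u)) (x∙yz≈y∙xz b a _)
      }

    linear-signed : ∀ k {f : Vector F N → Carrier} → Linear f → Linear (λ u → signed F k (f u))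
    linear-signed k lin = record
      { cong   = λ u≈v → signed-cong k (Linear.cong lin u≈v)
      ; +-homo = λ u v → trans (signed-cong k (Linear.+-homo lin u v)) (signed-+ k _ _)
      ; *-homo = λ a u → trans (signed-cong k (Linear.*-homo lin a u)) (signed-*ˡ k a _)
      }

    linear-∑ : ∀ {s} {f : Fin s → Vector F N → Carrier} → (∀ a → Linear (f a)) →
               Linear (λ u → ∑ F (λ a → f a u))
    linear-∑ {f = f} lin = record
      { cong   = λ u≈v → ∑-cong (λ a → Linear.cong (lin a) u≈v)
      ; +-homo = λ u v → trans (∑-cong (λ a → Linear.+-homo (lin a) u v))
                               (∑-distrib-+ (λ a → f a u) (λ a → f a v))
      ; *-homo = λ b u → trans (∑-cong (λ a → Linear.*-homo (lin a) b u)) (sym (*-distribˡ-∑ b (λ a → f a u)))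
      }

  linear-reindex : ∀ {M N} (σ : Fin M → Fin N) {f : Vector F M → Carrier} → Linear f →
                   Linear (λ u → f (u ∘ σ))
  linear-reindex σ lin = record
    { cong   = λ u≈v → Linear.cong lin (u≈v ∘ σ)
    ; +-homo = λ u v → Linear.+-homo lin (u ∘ σ) (v ∘ σ)
    ; *-homo = λ a u → Linear.*-homo lin a (u ∘ σ)
    }

  module _ {d N : ℕ} where
    Matrix : Set c
    Matrix = Fin d → Vector F N

    infix 4 _≋_
    _≋_ : Matrix → Matrix → Set ℓ
    xs ≋ ys = ∀ i k → xs i k ≈ ys i k

    ≡⇒≈ : ∀ {u v : Vector F N} → u ≡ v → ∀ k → u k ≈ v k
    ≡⇒≈ u≡v k = reflexive (≡.cong (λ row → row k) u≡v)

    update-≡ : ∀ (xs : Matrix) j u → update F xs j u j ≡ u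
    update-≡ xs j u with j ≟ j
    ... | yes _   = ≡.refl
    ... | no j≢j = contradiction ≡.refl j≢j

    update-≢ : ∀ (xs : Matrix) {j} u {i} → i ≢ j → update F xs j u i ≡ xs i
    update-≢ xs {j} u {i} i≢j with i ≟ j
    ... | yes i≡j = contradiction i≡j i≢j
    ... | no _    = ≡.refl

    update-cong : ∀ {xs ys : Matrix} j {u v : Vector F N} → xs ≋ ys → (∀ k → u k ≈ v k) →
                  update F xs j u ≋ update F ys j v
    update-cong j {u} {v} xs≋ys u≈v i with i ≟ j
    ... | yes _ = u≈v
    ... | no _  = xs≋ys i

    update-self : ∀ (xs : Matrix) j → update F xs j (xs j) ≋ xs
    update-self xs j i k with i ≟ j
    ... | yes ≡.refl = refl
    ... | no _       = refl

    update-self₂ : ∀ (xs : Matrix) i j → update F (update F xs i (xs i)) j (xs j) ≋ xs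
    update-self₂ xs i j m k = trans (update-cong j (update-self xs i) (λ _ → refl) m k) (update-self xs j m k)

    update-comm : ∀ (xs : Matrix) {i j} u v → i ≢ j →
                  update F (update F xs i u) j v ≋ update F (update F xs j v) i u
    update-comm xs {i} {j} u v i≢j m k with m ≟ i | m ≟ j
    ... | yes ≡.refl | yes ≡.refl = contradiction ≡.refl i≢j
    ... | yes ≡.refl | no _       = ≡⇒≈ (update-≡ xs i u) k
    ... | no _       | yes ≡.refl = ≡⇒≈ (≡.sym (update-≡ xs j v)) k
    ... | no m≢i     | no m≢j     = ≡⇒≈ (≡.trans (update-≢ xs u m≢i) (≡.sym (update-≢ xs v m≢j))) k

    module _ {S : Subset d} {f : Form F d N} (ml : MultilinearIn F S f) where
      multilinear-local : ∀ {xs ys} → (∀ j → j ∈ S → ∀ k → xs j k ≈ ys j k) → f xs ≈ f ys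
      multilinear-local = proj₁ ml _ _

      multilinear-cong : ∀ {xs ys} → xs ≋ ys → f xs ≈ f ys
      multilinear-cong xs≋ys = multilinear-local (λ j _ → xs≋ys j)

      multilinear-linear : ∀ {j} → j ∈ S → ∀ xs → Linear (λ u → f (update F xs j u))
      multilinear-linear j∈S xs = record
        { cong   = λ u≈v → multilinear-cong (update-cong _ (λ _ _ → refl) u≈v)
        ; +-homo = proj₁ (proj₂ ml) _ j∈S xs
        ; *-homo = proj₂ (proj₂ ml) _ j∈S xs
        }

    multilinear : ∀ {S : Subset d} {f : Form F d N} →
                  (∀ {xs ys} → (∀ j → j ∈ S → ∀ k → xs j k ≈ ys j k) → f xs ≈ f ys) →
                  (∀ {j} → j ∈ S → ∀ xs → Linear (λ u → f (update F xs j u))) →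
                  MultilinearIn F S f
    multilinear local lin = (λ _ _ → local)
                          , (λ _ j∈S xs → Linear.+-homo (lin j∈S xs))
                          , (λ _ j∈S xs → Linear.*-homo (lin j∈S xs))

    Alternating : Form F d N → Set (c ⊔ ℓ)
    Alternating T = ∀ xs {i j} → i ≢ j → (∀ k → xs i k ≈ xs j k) → T xs ≈ 0#

    swapRows : Matrix → Fin d → Fin d → Matrix
    swapRows xs i j = update F (update F xs i (xs j)) j (xs i)

    swapRows-first : ∀ (xs : Matrix) i j → swapRows xs i j i ≡ xs j
    swapRows-first xs i j with i ≟ j
    ... | yes ≡.refl = ≡.refl
    ... | no _       = update-≡ xs i (xs j)

    module _ {T : Form F d N} (ml : MultilinearIn F ⊤ T) (alt : Alternating T) where
      alternating-swap : ∀ xs {i j} → i ≢ j → T (swapRows xs i j) ≈ - T xs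
      alternating-swap xs {i} {j} i≢j = +-inverseˡ-unique _ _ (begin
        T (swapRows xs i j) + T xs                  ≈⟨ +-comm _ _ ⟩
        T xs + B xj xi                              ≈⟨ +-congʳ B-xs ⟨
        B xi xj + B xj xi                           ≈⟨ +-cong (+-identityˡ _) (+-identityʳ _) ⟨
        (0# + B xi xj) + (B xj xi + 0#)             ≈⟨ +-cong (+-congʳ (B-diagonal xi))
                                                              (+-congˡ (B-diagonal xj)) ⟨
        (B xi xi + B xi xj) + (B xj xi + B xj xj)   ≈⟨ +-cong (B-additiveʳ xi) (B-additiveʳ xj) ⟨
        B xi (xi ⊕ xj) + B xj (xi ⊕ xj)             ≈⟨ B-additiveˡ (xi ⊕ xj) ⟨
        B (xi ⊕ xj) (xi ⊕ xj)                       ≈⟨ B-diagonal (xi ⊕ xj) ⟩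
        0#                                          ∎)
        where
          xi = xs i
          xj = xs j
          _⊕_ : Vector F N → Vector F N → Vector F N
          (u ⊕ v) k = u k + v k
          B : Vector F N → Vector F N → Carrier
          B u v = T (update F (update F xs i u) j v)
          B-diagonal : ∀ u → B u u ≈ 0#
          B-diagonal u = alt _ i≢j (≡⇒≈ (≡.trans (update-≢ (update F xs i u) u i≢j)
                                         (≡.trans (update-≡ xs i u) (≡.sym (update-≡ (update F xs i u) j u)))))
          B-additiveʳ : ∀ u → B u (xi ⊕ xj) ≈ B u xi + B u xj
          B-additiveʳ u = Linear.+-homo (multilinear-linear ml ∈⊤ (update F xs i u)) xi xj
          B-additiveˡ : ∀ v → B (xi ⊕ xj) v ≈ B xi v + B xj v
          B-additiveˡ v = begin
            B (xi ⊕ xj) v                   ≈⟨ multilinear-cong ml (update-comm xs _ v i≢j) ⟩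
            T (update F (update F xs j v) i (xi ⊕ xj))
              ≈⟨ Linear.+-homo (multilinear-linear ml ∈⊤ (update F xs j v)) xi xj ⟩
            T (update F (update F xs j v) i xi) + T (update F (update F xs j v) i xj)
              ≈⟨ +-cong (multilinear-cong ml (update-comm xs xi v i≢j))
                        (multilinear-cong ml (update-comm xs xj v i≢j)) ⟨
            B xi v + B xj v                 ∎
          B-xs : B xi xj ≈ T xs
          B-xs = multilinear-cong ml (update-self₂ xs i j)

      swapRows-nonzero : ∀ {xs} → ¬ T xs ≈ 0# → ∀ i j → ¬ T (swapRows xs i j) ≈ 0#
      swapRows-nonzero {xs} Txs≉0 i j with i ≟ j
      ... | yes ≡.refl = λ T≈0 → Txs≉0 (trans (sym (multilinear-cong ml (update-self₂ xs i i))) T≈0)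
      ... | no i≢j     = λ T≈0 → -‿nonzero Txs≉0 (trans (sym (alternating-swap xs i≢j)) T≈0)

      alternating-update-∑ : ∀ xs k (a : Fin d → Carrier) →
                             T (update F xs k (λ m → ∑ F (λ j → a j * xs j m))) ≈ a k * T xs
      alternating-update-∑ xs k a = begin
        T (update F xs k (λ m → ∑ F (λ j → a j * xs j m)))
          ≈⟨ linear-combination (multilinear-linear ml ∈⊤ xs) a xs ⟩
        ∑ F (λ j → a j * T (update F xs k (xs j)))
          ≈⟨ ∑-single _ k other-rows-vanish ⟩
        a k * T (update F xs k (xs k))
          ≈⟨ *-congˡ (multilinear-cong ml (update-self xs k)) ⟩
        a k * T xs
          ∎
        where
          other-rows-vanish : ∀ j → j ≢ k → a j * T (update F xs k (xs j)) ≈ 0#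
          other-rows-vanish j j≢k = trans (*-congˡ (alt _ (j≢k ∘ ≡.sym) rows-k-and-j-equal)) (zeroʳ _)
            where
              rows-k-and-j-equal = ≡⇒≈ (≡.trans (update-≡ xs k (xs j)) (≡.sym (update-≢ xs (xs j) j≢k)))

    OnSlice : Subset d → Matrix → Matrix → Set ℓ
    OnSlice J w x = ∀ j → j ∉ J → ∀ k → x j k ≈ w j k

    OnSlice-update : ∀ {J w x j} → j ∈ J → OnSlice J w x → ∀ u → OnSlice J w (update F x j u)
    OnSlice-update {x = x} j∈J x-on u i i∉J k =
      trans (≡⇒≈ (update-≢ x u (λ { ≡.refl → i∉J j∈J })) k) (x-on i i∉J k)

    OnSlice-remove : ∀ {J w x k} → OnSlice J w x → OnSlice (J - k) (update F w k (x k)) x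
    OnSlice-remove {J} {w} {x} {k} x-on j j∉J-k m with j ≟ k
    ... | yes ≡.refl = refl
    ... | no j≢k     = x-on j (λ j∈J → j∉J-k (x∈p∧x≢y⇒x∈p-y j∈J j≢k)) m

    OnSlice-restrict : ∀ {J w z k} u → k ∈ J → OnSlice (J - k) (update F w k u) z → OnSlice J w z
    OnSlice-restrict {J} {w} {z} {k} u k∈J z-on j j∉J m =
      trans (z-on j (j∉J ∘ p─q⊆p J _) m) (≡⇒≈ (update-≢ w u (λ { ≡.refl → j∉J k∈J })) m)

    constant-on-slice : ∀ {S J : Subset d} {f : Form F d N} → MultilinearIn F S f → ¬ Nonempty (J ∩ S) →
                        ∀ {w z} → OnSlice J w z → f z ≈ f w
    constant-on-slice ml J∩S≡∅ z-on =
      multilinear-local ml (λ j j∈S → z-on j (λ j∈J → J∩S≡∅ (j , x∈p∩q⁺ (j∈J , j∈S))))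

module LinearSystems {c ℓ} (F : Field c ℓ) where
  open FieldAlgebra F
  open DoubleNegation

  module _ {d : ℕ} where
    infix 7 _·_
    _·_ : Vector F d → Vector F d → Carrier
    u · v = ∑ F (λ j → u j * v j)

    ·-linearˡ : ∀ α β (u v w : Vector F d) → (λ j → α * u j + β * v j) · w ≈ α * (u · w) + β * (v · w)
    ·-linearˡ α β u v w = begin
      ∑ F (λ j → (α * u j + β * v j) * w j)
        ≈⟨ ∑-cong (λ j → trans (distribʳ (w j) _ _) (+-cong (*-assoc α _ _) (*-assoc β _ _))) ⟩
      ∑ F (λ j → α * (u j * w j) + β * (v j * w j))
        ≈⟨ ∑-distrib-+ (λ j → α * (u j * w j)) (λ j → β * (v j * w j)) ⟩
      ∑ F (λ j → α * (u j * w j)) + ∑ F (λ j → β * (v j * w j))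
        ≈⟨ +-cong (*-distribˡ-∑ α (λ j → u j * w j)) (*-distribˡ-∑ β (λ j → v j * w j)) ⟨
      α * (u · w) + β * (v · w)
        ∎

    ·-comm : ∀ (u v : Vector F d) → u · v ≈ v · u
    ·-comm u v = ∑-cong (λ j → *-comm (u j) (v j))

    ·-linearʳ : ∀ α β (u v w : Vector F d) → w · (λ j → α * u j + β * v j) ≈ α * (w · u) + β * (w · v)
    ·-linearʳ α β u v w = begin
      w · (λ j → α * u j + β * v j)  ≈⟨ ·-comm w _ ⟩
      (λ j → α * u j + β * v j) · w  ≈⟨ ·-linearˡ α β u v w ⟩
      α * (u · w) + β * (v · w)      ≈⟨ +-cong (*-congˡ (·-comm u w)) (*-congˡ (·-comm v w)) ⟩
      α * (w · u) + β * (w · v)      ∎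

    δ-· : ∀ i (v : Vector F d) → δ i · v ≈ v i
    δ-· i v = begin
      δ i · v      ≈⟨ ∑-single _ i (λ j j≢i → trans (*-congʳ (δ-off-diagonal j≢i)) (zeroˡ (v j))) ⟩
      δ i i * v i  ≈⟨ *-congʳ (δ-diagonal i) ⟩
      1# * v i     ≈⟨ *-identityˡ (v i) ⟩
      v i          ∎

  record NonzeroSolution {d q} (P : Subset d) (E : Subset q) (a : Fin q → Vector F d) : Set (c ⊔ ℓ) where
    field
      x         : Vector F d
      x-outside : ∀ j → j ∉ P → x j ≈ 0#
      pivot     : Fin d
      pivot∈P   : pivot ∈ P
      x-pivot   : ¬ x pivot ≈ 0#
      solves    : ∀ t → t ∈ E → x · a t ≈ 0#

  module _ {d : ℕ} {P : Subset d} where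
    ¬¬-vanishes-or-nonzero : ∀ (v : Vector F d) →
                             ¬ ¬ ((∀ j → j ∈ P → v j ≈ 0#) ⊎ ∃ λ j → j ∈ P × ¬ v j ≈ 0#)
    ¬¬-vanishes-or-nonzero v ¬goal = ¬¬-Π-Fin pointwise (¬goal ∘ inj₁)
      where
        pointwise : ∀ j → ¬ ¬ (j ∈ P → v j ≈ 0#)
        pointwise j ¬h = ¬h (λ j∈P → contradiction (inj₂ (j , j∈P , λ vj≈0 → ¬h (λ _ → vj≈0))) ¬goal)

    supported-·-vanishing : ∀ {x v : Vector F d} →
                            (∀ j → j ∉ P → x j ≈ 0#) → (∀ j → j ∈ P → v j ≈ 0#) → x · v ≈ 0#
    supported-·-vanishing {x} {v} x-outside v-inside = ∑-zero term≈0
      where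
        term≈0 : ∀ j → x j * v j ≈ 0#
        term≈0 j with j ∈? P
        ... | yes j∈P = trans (*-congˡ (v-inside j j∈P)) (zeroʳ (x j))
        ... | no  j∉P = trans (*-congʳ (x-outside j j∉P)) (zeroˡ (v j))

    add-equation : ∀ {q s} {E : Subset q} {a : Fin (suc q) → Vector F d}
                   (sol : NonzeroSolution P E (a ∘ suc)) →
                   (zero ∈ s ∷ E → NonzeroSolution.x sol · a zero ≈ 0#) → NonzeroSolution P (s ∷ E) a
    add-equation sol first = record
      { x = x ; x-outside = x-outside ; pivot = pivot ; pivot∈P = pivot∈P ; x-pivot = x-pivot
      ; solves = λ { zero 0∈E → first 0∈E ; (suc t) (there t∈E) → solves t t∈E }
      }
      where open NonzeroSolution sol

  -‿*-swap : ∀ x y → - x * y ≈ - y * x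
  -‿*-swap x y = begin
    - x * y    ≈⟨ -‿distribˡ-* x y ⟨
    - (x * y)  ≈⟨ -‿cong (*-comm x y) ⟩
    - (y * x)  ≈⟨ -‿distribˡ-* y x ⟩
    - y * x    ∎

  module _ {d q : ℕ} {P : Subset d} {j₀ : Fin d} (j₀∈P : j₀ ∈ P) {a : Fin (suc q) → Vector F d} where
    private
      α = a zero j₀

    -- α times equation t + 1 minus (a (suc t) j₀) times equation 0: no division needed.
    eliminated : Fin q → Vector F d
    eliminated t j = α * a (suc t) j + - a (suc t) j₀ * a zero j

    eliminate-pivot : ∀ {E} → ¬ α ≈ 0# →
                      NonzeroSolution (P - j₀) E eliminated → NonzeroSolution P (inside ∷ E) a
    eliminate-pivot {E} α≉0 sol = record
      { x = x
      ; x-outside = x-outside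
      ; pivot = pivot
      ; pivot∈P = p─q⊆p P _ pivot∈P
      ; x-pivot = λ x≈0 → *-nonzero α≉0 y-pivot (trans (sym x-pivot≈) x≈0)
      ; solves = solves′
      }
      where
        open NonzeroSolution sol
          renaming (x to y; x-outside to y-outside; x-pivot to y-pivot; solves to y-solves)
        S₀ = y · a zero
        x : Vector F d
        x j = α * y j + - S₀ * δ j₀ j
        x-off-j₀ : ∀ {j} → j ≢ j₀ → x j ≈ α * y j
        x-off-j₀ j≢j₀ = trans (+-congˡ (trans (*-congˡ (δ-off-diagonal j≢j₀)) (zeroʳ _))) (+-identityʳ _)
        x-outside : ∀ j → j ∉ P → x j ≈ 0#
        x-outside j j∉P = trans (x-off-j₀ (λ { ≡.refl → j∉P j₀∈P }))
                                (trans (*-congˡ (y-outside j (j∉P ∘ p─q⊆p P _))) (zeroʳ α))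
        x-pivot≈ : x pivot ≈ α * y pivot
        x-pivot≈ = x-off-j₀ (λ { ≡.refl → x∉p-x j₀ pivot∈P })
        x·row : ∀ r → x · r ≈ α * (y · r) + - S₀ * r j₀
        x·row r = trans (·-linearˡ α (- S₀) y (δ j₀) r) (+-congˡ (*-congˡ (δ-· j₀ r)))
        solves′ : ∀ t → t ∈ inside ∷ E → x · a t ≈ 0#
        solves′ zero here = begin
          x · a zero               ≈⟨ x·row (a zero) ⟩
          α * S₀ + - S₀ * α        ≈⟨ +-congˡ (trans (sym (-‿distribˡ-* S₀ α)) (-‿cong (*-comm S₀ α))) ⟩
          α * S₀ + - (α * S₀)      ≈⟨ -‿inverseʳ (α * S₀) ⟩
          0#                       ∎
        solves′ (suc t) (there t∈E) = begin
          x · a (suc t)                             ≈⟨ x·row (a (suc t)) ⟩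
          α * (y · a (suc t)) + - S₀ * a (suc t) j₀ ≈⟨ +-congˡ (-‿*-swap S₀ (a (suc t) j₀)) ⟩
          α * (y · a (suc t)) + - a (suc t) j₀ * S₀ ≈⟨ ·-linearʳ α (- a (suc t) j₀) (a (suc t)) (a zero) y ⟨
          y · eliminated t                          ≈⟨ y-solves t t∈E ⟩
          0#                                        ∎

  fewer-equations-than-unknowns : ∀ {d q} (P : Subset d) (E : Subset q) (a : Fin q → Vector F d) →
                                  ∣ E ∣ < ∣ P ∣ → ¬ ¬ NonzeroSolution P E a
  fewer-equations-than-unknowns P [] a 0<∣P∣ k with 0<∣p∣⇒Nonempty {p = P} 0<∣P∣
  ... | j₀ , j₀∈P = k (record
    { x = δ j₀
    ; x-outside = λ j j∉P → δ-off-diagonal {i = j₀} {j} (λ { ≡.refl → j∉P j₀∈P })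
    ; pivot = j₀
    ; pivot∈P = j₀∈P
    ; x-pivot = λ δ≈0 → 0≉1 (trans (sym δ≈0) (δ-diagonal j₀))
    ; solves = λ _ ()
    })
  fewer-equations-than-unknowns P (outside ∷ E) a ∣E∣<∣P∣ =
    ¬¬-map (λ sol → add-equation sol λ ()) (fewer-equations-than-unknowns P E (a ∘ suc) ∣E∣<∣P∣)
  fewer-equations-than-unknowns P (inside ∷ E) a ∣E∣<∣P∣ = ¬¬-vanishes-or-nonzero {P = P} (a zero) >>= λ
    { (inj₁ a₀-vanishes) →
        ¬¬-map (λ sol → add-equation sol λ _ →
                  supported-·-vanishing (NonzeroSolution.x-outside sol) a₀-vanishes)
               (fewer-equations-than-unknowns P E (a ∘ suc) (<-trans (n<1+n _) ∣E∣<∣P∣))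
    ; (inj₂ (j₀ , j₀∈P , a₀≉0)) →
        ¬¬-map (eliminate-pivot j₀∈P a₀≉0)
               (fewer-equations-than-unknowns (P - j₀) E (eliminated j₀∈P {a = a})
                 (≤-pred (subst (suc (suc ∣ E ∣) ≤_) (x∈p⇒∣p∣≡suc∣p-x∣ j₀∈P) ∣E∣<∣P∣)))
    }

module Determinant {c ℓ} (F : Field c ℓ) where
  open FieldAlgebra F
  open Forms F

  minor : ∀ {n} → Fin (suc n) → Matrix {suc n} {suc n} → Matrix {n} {n}
  minor a M i k = M (suc i) (punchIn a k)

  det-cong : ∀ n {M M′ : Matrix {n} {n}} → M ≋ M′ → det F n M ≈ det F n M′
  det-cong zero    M≋M′ = refl
  det-cong (suc n) M≋M′ = ∑-cong λ a →
    signed-cong (toℕ a) (*-cong (M≋M′ zero a) (det-cong n (λ i k → M≋M′ (suc i) (punchIn a k))))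

  minor-update : ∀ {n} a (M : Matrix {suc n} {suc n}) r u →
                 minor a (update F M (suc r) u) ≋ update F (minor a M) r (u ∘ punchIn a)
  minor-update a M r u i k with suc i ≟ suc r | i ≟ r
  ... | yes _    | yes _   = refl
  ... | no _     | no _    = refl
  ... | yes 1+i≡1+r | no i≢r = contradiction (suc-injective 1+i≡1+r) i≢r
  ... | no 1+i≢1+r  | yes i≡r = contradiction (≡.cong suc i≡r) 1+i≢1+r

  det-update-suc : ∀ n (M : Matrix {suc n} {suc n}) r u →
    det F (suc n) (update F M (suc r) u) ≈
    ∑ F (λ a → signed F (toℕ a) (M zero a * det F n (update F (minor a M) r (u ∘ punchIn a))))
  det-update-suc n M r u = ∑-cong λ a →
    signed-cong (toℕ a) (*-congˡ {M zero a} (det-cong n (minor-update a M r u)))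

  det-linear : ∀ n (M : Matrix {n} {n}) r → Linear (λ u → det F n (update F M r u))
  det-linear (suc n) M zero    = linear-∑ λ a →
    linear-signed (toℕ a) (linear-*ʳ (linear-coordinate a) (det F n (minor a M)))
  det-linear (suc n) M (suc r) = linear-cong (λ u → sym (det-update-suc n M r u)) (linear-∑ λ a →
    linear-signed (toℕ a) (linear-*ˡ (M zero a) (linear-reindex (punchIn a) (det-linear n (minor a M) r))))

  det-multilinear : ∀ n → MultilinearIn F ⊤ (det F n)
  det-multilinear n = multilinear (λ agree → det-cong n (λ i → agree i ∈⊤)) (λ {r} _ M → det-linear n M r)

  det-identity : ∀ n → det F n δ ≈ 1#
  det-identity zero    = refl
  det-identity (suc n) = begin
    1# * det F n δ + ∑ F (λ a → signed F (toℕ (suc a)) (0# * det F n (minor (suc a) δ)))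
      ≈⟨ +-cong (*-identityˡ _) (∑-zero λ a → signed-vanishes (suc (toℕ a)) (zeroˡ (det F n (minor (suc a) δ)))) ⟩
    det F n δ + 0#  ≈⟨ +-identityʳ _ ⟩
    det F n δ       ≈⟨ det-identity n ⟩
    1#              ∎

  Extensional : ∀ {n m} → ((Fin n → Fin m) → Carrier) → Set ℓ
  Extensional H = ∀ {σ τ} → (∀ k → σ k ≡ τ k) → H σ ≈ H τ

  doubleExpansion : ∀ n → Vector F (suc (suc n)) → ((Fin n → Fin (suc (suc n))) → Carrier) → Carrier
  doubleExpansion n v H = ∑ F λ a → signed F (toℕ a) (v a *
                          ∑ F λ b → signed F (toℕ b) (v (punchIn a b) * H (punchIn a ∘ punchIn b)))

  -- The terms with a = 0 cancel those with b = 0, and the terms with a, b ≥ 1 form the double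
  -- expansion of v ∘ suc, one size smaller.
  mutual
    doubleExpansion-vanishes : ∀ n v H → Extensional H → doubleExpansion n v H ≈ 0#
    doubleExpansion-vanishes n v H ext = begin
      G + ∑ F (λ a → signed F (suc (toℕ a)) (v (suc a) * (v zero * h a + R a)))
                                 ≈⟨ +-congˡ (∑-cong split) ⟩
      G + ∑ F (λ a → X a + Y a)  ≈⟨ +-congˡ (∑-distrib-+ X Y) ⟩
      G + (∑ F X + ∑ F Y)        ≈⟨ +-congˡ (+-cong ∑X≈-G (later-pairs-vanish n v H ext)) ⟩
      G + (- G + 0#)             ≈⟨ +-congˡ (+-identityʳ (- G)) ⟩
      G + - G                    ≈⟨ -‿inverseʳ G ⟩
      0#                         ∎
      where
        h : Fin (suc n) → Carrier
        h a = H (λ k → suc (punchIn a k))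
        g : Fin (suc n) → Carrier
        g a = signed F (toℕ a) (v (suc a) * h a)
        G = v zero * ∑ F g
        R X Y : Fin (suc n) → Carrier
        R a = ∑ F λ b →
          signed F (suc (toℕ b)) (v (punchIn (suc a) (suc b)) * H (punchIn (suc a) ∘ punchIn (suc b)))
        X a = signed F (suc (toℕ a)) (v (suc a) * (v zero * h a))
        Y a = signed F (suc (toℕ a)) (v (suc a) * R a)
        split : ∀ a → signed F (suc (toℕ a)) (v (suc a) * (v zero * h a + R a)) ≈ X a + Y a
        split a = trans (signed-cong (suc (toℕ a)) (distribˡ (v (suc a)) _ _)) (signed-+ (suc (toℕ a)) _ _)
        X≈ : ∀ a → X a ≈ - (v zero * g a)
        X≈ a = begin
          signed F (suc (toℕ a)) (v (suc a) * (v zero * h a)) ≈⟨ signed-suc (toℕ a) _ ⟩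
          - signed F (toℕ a) (v (suc a) * (v zero * h a))     ≈⟨ -‿cong (signed-cong (toℕ a) (x∙yz≈y∙xz _ _ _)) ⟩
          - signed F (toℕ a) (v zero * (v (suc a) * h a))     ≈⟨ -‿cong (signed-*ˡ (toℕ a) (v zero) _) ⟩
          - (v zero * g a)                                    ∎
        ∑X≈-G : ∑ F X ≈ - G
        ∑X≈-G = begin
          ∑ F X                         ≈⟨ ∑-cong X≈ ⟩
          ∑ F (λ a → - (v zero * g a))  ≈⟨ -‿distrib-∑ (λ a → v zero * g a) ⟨
          - ∑ F (λ a → v zero * g a)    ≈⟨ -‿cong (*-distribˡ-∑ (v zero) g) ⟨
          - G                           ∎

    later-pairs-vanish : ∀ n v H → Extensional H →
      ∑ F (λ a → signed F (suc (toℕ a)) (v (suc a) * ∑ F λ b →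
        signed F (suc (toℕ b)) (v (punchIn (suc a) (suc b)) * H (punchIn (suc a) ∘ punchIn (suc b))))) ≈ 0#
    later-pairs-vanish zero    v H ext = ∑-zero λ a → signed-vanishes (suc (toℕ a)) (zeroʳ (v (suc a)))
    later-pairs-vanish (suc n) v H ext =
      trans (∑-cong term≈) (doubleExpansion-vanishes n (v ∘ suc) (H ∘ lift 1) ext′)
      where
        ext′ : Extensional (H ∘ lift 1)
        ext′ σ≗τ = ext λ { zero → ≡.refl ; (suc k) → ≡.cong suc (σ≗τ k) }
        pair pair′ : Fin (suc (suc n)) → Fin (suc n) → Carrier
        pair  a b = v (suc (punchIn a b)) * H (punchIn (suc a) ∘ punchIn (suc b))
        pair′ a b = v (suc (punchIn a b)) * H (lift 1 (punchIn a ∘ punchIn b))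
        pair≈pair′ : ∀ a b → pair a b ≈ pair′ a b
        pair≈pair′ a b = *-congˡ (ext λ { zero → ≡.refl ; (suc k) → ≡.refl })
        S : Fin (suc (suc n)) → Carrier
        S a = ∑ F λ b → signed F (toℕ b) (pair′ a b)
        term≈ : ∀ a → signed F (suc (toℕ a)) (v (suc a) * ∑ F (λ b → signed F (suc (toℕ b)) (pair a b)))
                      ≈ signed F (toℕ a) (v (suc a) * S a)
        term≈ a = begin
          signed F (suc (toℕ a)) (v (suc a) * ∑ F (λ b → signed F (suc (toℕ b)) (pair a b)))
            ≈⟨ signed-cong (suc (toℕ a)) (*-congˡ (∑-cong λ b → signed-suc (toℕ b) (pair a b))) ⟩
          signed F (suc (toℕ a)) (v (suc a) * ∑ F (λ b → - signed F (toℕ b) (pair a b)))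
            ≈⟨ signed-cong (suc (toℕ a)) (*-congˡ (∑-cong λ b →
                 -‿cong (signed-cong (toℕ b) (pair≈pair′ a b)))) ⟩
          signed F (suc (toℕ a)) (v (suc a) * ∑ F (λ b → - signed F (toℕ b) (pair′ a b)))
            ≈⟨ signed-cong (suc (toℕ a)) (*-congˡ (-‿distrib-∑ (λ b → signed F (toℕ b) (pair′ a b)))) ⟨
          signed F (suc (toℕ a)) (v (suc a) * - S a)
            ≈⟨ signed-cong (suc (toℕ a)) (-‿distribʳ-* (v (suc a)) (S a)) ⟨
          signed F (suc (toℕ a)) (- (v (suc a) * S a))
            ≈⟨ signed-suc-‿ (toℕ a) _ ⟩
          signed F (toℕ a) (v (suc a) * S a)
            ∎

  det-equal-first-rows : ∀ n (M : Matrix {suc (suc n)} {suc (suc n)}) →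
                         (∀ k → M zero k ≈ M (suc zero) k) → det F (suc (suc n)) M ≈ 0#
  det-equal-first-rows n M row₀≈row₁ = begin
    det F (suc (suc n)) M          ≈⟨ ∑-cong (λ a → signed-cong (toℕ a) (*-congˡ {M zero a} (∑-cong λ b →
                                        signed-cong (toℕ b) (*-congʳ {H (punchIn a ∘ punchIn b)}
                                                                     (sym (row₀≈row₁ (punchIn a b))))))) ⟩
    doubleExpansion n (M zero) H   ≈⟨ doubleExpansion-vanishes n (M zero) H H-extensional ⟩
    0#                             ∎
    where
      H : (Fin n → Fin (suc (suc n))) → Carrier
      H σ = det F n (λ i k → M (suc (suc i)) (σ k))
      H-extensional : Extensional H
      H-extensional σ≗τ = det-cong n (λ i k → reflexive (≡.cong (M (suc (suc i))) (σ≗τ k)))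

  det-swap-lower-rows : ∀ n → Alternating (det F n) → ∀ (M : Matrix {suc n} {suc n}) {i j} → i ≢ j →
                        det F (suc n) (swapRows M (suc i) (suc j)) ≈ - det F (suc n) M
  det-swap-lower-rows n det-alternating M {i} {j} i≢j = begin
    det F (suc n) (swapRows M (suc i) (suc j))
      ≈⟨ ∑-cong (λ a → signed-cong (toℕ a) (*-congˡ {M zero a} (minor-swapped a))) ⟩
    ∑ F (λ a → signed F (toℕ a) (M zero a * - D a))
      ≈⟨ ∑-cong (λ a → trans (signed-cong (toℕ a) (sym (-‿distribʳ-* (M zero a) (D a)))) (signed-‿ (toℕ a) _)) ⟩
    ∑ F (λ a → - signed F (toℕ a) (M zero a * D a))
      ≈⟨ -‿distrib-∑ (λ a → signed F (toℕ a) (M zero a * D a)) ⟨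
    - det F (suc n) M
      ∎
    where
      D : Fin (suc n) → Carrier
      D a = det F n (minor a M)
      minor-swapped : ∀ a → det F n (minor a (swapRows M (suc i) (suc j))) ≈ - D a
      minor-swapped a = trans (det-cong n minor≋swapped)
                              (alternating-swap (det-multilinear n) det-alternating (minor a M) i≢j)
        where
          minor≋swapped : minor a (swapRows M (suc i) (suc j)) ≋ swapRows (minor a M) i j
          minor≋swapped r k = trans (minor-update a (update F M (suc i) (M (suc j))) j (M (suc i)) r k)
                                    (update-cong j (minor-update a M i (M (suc j))) (λ _ → refl) r k)

  mutual
    det-alternating : ∀ n → Alternating (det F n)
    det-alternating (suc n) M {zero}  {zero}  0≢0 _ = contradiction ≡.refl 0≢0
    det-alternating (suc n) M {zero}  {suc j} _   row₀≈rowⱼ = det-first-row-repeated n M j row₀≈rowⱼ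
    det-alternating (suc n) M {suc i} {zero}  _   rowᵢ≈row₀ = det-first-row-repeated n M i (sym ∘ rowᵢ≈row₀)
    det-alternating (suc n) M {suc i} {suc j} i≢j rowᵢ≈rowⱼ = ∑-zero λ a → signed-vanishes (toℕ a)
      (trans (*-congˡ {M zero a} (det-alternating n (minor a M) (i≢j ∘ ≡.cong suc) (rowᵢ≈rowⱼ ∘ punchIn a)))
             (zeroʳ _))

    det-first-row-repeated : ∀ n (M : Matrix {suc n} {suc n}) j →
                             (∀ k → M zero k ≈ M (suc j) k) → det F (suc n) M ≈ 0#
    det-first-row-repeated (suc n)       M zero    row₀≈row₁ = det-equal-first-rows n M row₀≈row₁
    det-first-row-repeated (suc (suc n)) M (suc j) row₀≈rowⱼ = begin
      det F _ M     ≈⟨ -‿involutive _ ⟨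
      - - det F _ M ≈⟨ -‿cong (det-swap-lower-rows _ (det-alternating (suc (suc n))) M {zero} {suc j} λ ()) ⟨
      - det F _ M′  ≈⟨ -‿cong (det-equal-first-rows (suc n) M′ row₀≈rowⱼ) ⟩
      - 0#          ≈⟨ -0#≈0# ⟩
      0#            ∎
      where
        M′ = swapRows M (suc zero) (suc (suc j))

module PartitionRankOfAlternatingForms {c ℓ} (F : Field c ℓ) where
  open FieldAlgebra F
  open Forms F
  open LinearSystems F
  open DoubleNegation

  module _ {d N : ℕ} {T : Form F d N} (T-multilinear : MultilinearIn F ⊤ T) (T-alternating : Alternating T)
           {r : ℕ} {I : Fin r → Subset d} {Q R : Fin r → Form F d N}
           (Q-multilinear : ∀ i → MultilinearIn F (I i) (Q i))
           (R-multilinear : ∀ i → MultilinearIn F (∁ (I i)) (R i))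
           (T≈∑QR : ∀ xs → T xs ≈ ∑ F (λ i → Q i xs * R i xs)) where

    record Admissible (L : Subset r) (J : Subset d) (w : Matrix) : Set (c ⊔ ℓ) where
      field
        point          : Matrix
        point-on-slice : OnSlice J w point
        T-point≉0      : ¬ T point ≈ 0#
        split⇒∈L       : ∀ i → Splits J (I i) → i ∈ L
        unsplit-vanish : ∀ i → ¬ Splits J (I i) → ∀ z → OnSlice J w z → Q i z * R i z ≈ 0#

    factorWithRow : Fin r → Fin d → Form F d N
    factorWithRow i k with k ∈? I i
    ... | yes _ = Q i
    ... | no _  = R i

    factorWithRow-linear : ∀ i k w → Linear (λ u → factorWithRow i k (update F w k u))
    factorWithRow-linear i k w with k ∈? I i
    ... | yes k∈I = multilinear-linear (Q-multilinear i) k∈I w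
    ... | no  k∉I = multilinear-linear (R-multilinear i) (x∉p⇒x∈∁p k∉I) w

    -- J - k misses the side of I i that contains k, so that factor is constant on the new slice.
    newly-unsplit-vanish : ∀ {J k w′ i} → Splits J (I i) → ¬ Splits (J - k) (I i) →
                           factorWithRow i k w′ ≈ 0# → ∀ z → OnSlice (J - k) w′ z → Q i z * R i z ≈ 0#
    newly-unsplit-vanish {J} {k} {w′} {i} (J∩I≢∅ , J∩∁I≢∅) unsplit′ factor≈0 z z-on with k ∈? I i
    ... | yes k∈I = trans (*-congʳ Qz≈0) (zeroˡ _)
      where
        J-k∩I≡∅ : ¬ Nonempty ((J - k) ∩ I i)
        J-k∩I≡∅ J-k∩I≢∅ = unsplit′ (J-k∩I≢∅ , Nonempty-∩-remove (x∈p⇒x∉∁p k∈I) J∩∁I≢∅)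
        Qz≈0 : Q i z ≈ 0#
        Qz≈0 = trans (constant-on-slice (Q-multilinear i) J-k∩I≡∅ z-on) factor≈0
    ... | no k∉I = trans (*-congˡ Rz≈0) (zeroʳ _)
      where
        J-k∩∁I≡∅ : ¬ Nonempty ((J - k) ∩ ∁ (I i))
        J-k∩∁I≡∅ J-k∩∁I≢∅ = unsplit′ (Nonempty-∩-remove k∉I J∩I≢∅ , J-k∩∁I≢∅)
        Rz≈0 : R i z ≈ 0#
        Rz≈0 = trans (constant-on-slice (R-multilinear i) J-k∩∁I≡∅ z-on) factor≈0

    -- Row k is frozen at a combination u = ∑ γ j * x j of the rows of the current point x, chosen so
    -- that for every term of L the factor involving row k vanishes at u: these are |L| < |J| linear
    -- equations in the γ j, j ∈ J.  Writing u into the pivot row multiplies T x by γ pivot, and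
    -- swapping the pivot row with row k only changes the sign.
    remove-row : ∀ {L J w k} → Admissible L J w → k ∈ J → ∣ L ∣ < ∣ J ∣ →
                 ¬ ¬ Σ Matrix (Admissible L (J - k))
    remove-row {L} {J} {w} {k} adm k∈J ∣L∣<∣J∣ =
      ¬¬-map admissible′ (fewer-equations-than-unknowns J L (λ i j → φ i (x j)) ∣L∣<∣J∣)
      where
        open Admissible adm renaming (point to x)
        φ : Fin r → Vector F N → Carrier
        φ i u = factorWithRow i k (update F w k u)
        admissible′ : NonzeroSolution J L (λ i j → φ i (x j)) → Σ Matrix (Admissible L (J - k))
        admissible′ sol = update F w k u , record
          { point          = x′
          ; point-on-slice = subst (λ v → OnSlice (J - k) (update F w k v) x′) x′-row-k
                                   (OnSlice-remove x′-on-slice)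
          ; T-point≉0      = swapRows-nonzero T-multilinear T-alternating T-x″≉0 k pivot
          ; split⇒∈L       = λ i split → split⇒∈L i (Splits-mono (p─q⊆p J _) split)
          ; unsplit-vanish = unsplit-vanish′
          }
          where
            open NonzeroSolution sol renaming (x to γ)
            u : Vector F N
            u m = ∑ F (λ j → γ j * x j m)
            x″ x′ : Matrix
            x″ = update F x pivot u
            x′ = swapRows x″ k pivot
            x′-row-k : x′ k ≡ u
            x′-row-k = ≡.trans (swapRows-first x″ k pivot) (update-≡ x pivot u)
            x′-on-slice : OnSlice J w x′
            x′-on-slice =
              OnSlice-update pivot∈P (OnSlice-update k∈J (OnSlice-update pivot∈P point-on-slice u) _) _
            T-x″≉0 : ¬ T x″ ≈ 0#
            T-x″≉0 Tx″≈0 = *-nonzero x-pivot T-point≉0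
              (trans (sym (alternating-update-∑ T-multilinear T-alternating x pivot γ)) Tx″≈0)
            φu≈0 : ∀ i → i ∈ L → φ i u ≈ 0#
            φu≈0 i i∈L = trans (linear-combination (factorWithRow-linear i k w) γ x) (solves i i∈L)
            unsplit-vanish′ : ∀ i → ¬ Splits (J - k) (I i) →
                              ∀ z → OnSlice (J - k) (update F w k u) z → Q i z * R i z ≈ 0#
            unsplit-vanish′ i unsplit′ z z-on with splits? J (I i)
            ... | yes split  = newly-unsplit-vanish split unsplit′ (φu≈0 i (split⇒∈L i split)) z z-on
            ... | no unsplit = unsplit-vanish i unsplit z (OnSlice-restrict u k∈J z-on)

    remove-rows : ∀ {L J J′ w} → Acc _⊂_ J → Admissible L J w → J′ ⊆ J → ∣ L ∣ ≤ ∣ J′ ∣ →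
                  ¬ ¬ Σ Matrix (Admissible L J′)
    remove-rows {L} {J} {J′} {w} (acc smaller) adm J′⊆J ∣L∣≤∣J′∣ with nonempty? (J ∩ ∁ J′)
    ... | no J∩∁J′≡∅ = λ ¬goal → ¬goal (w , subst (λ J → Admissible L J w) J≡J′ adm)
      where
        J≡J′ = ⊆-antisym (Empty-∩∁⇒⊆ J∩∁J′≡∅) J′⊆J
    ... | yes (k , k∈J∩∁J′) = remove-row adm k∈J ∣L∣<∣J∣ >>= λ
      { (w′ , adm′) → remove-rows (smaller (x∈p⇒p-x⊂p k∈J)) adm′ J′⊆J-k ∣L∣≤∣J′∣ }
      where
        k∈J = proj₁ (x∈p∩q⁻ J (∁ J′) k∈J∩∁J′)
        k∉J′ = x∈∁p⇒x∉p (proj₂ (x∈p∩q⁻ J (∁ J′) k∈J∩∁J′))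
        ∣L∣<∣J∣ = ≤-<-trans ∣L∣≤∣J′∣ (p⊂q⇒∣p∣<∣q∣ (J′⊆J , k , k∈J , k∉J′))
        J′⊆J-k : J′ ⊆ J - k
        J′⊆J-k j∈J′ = x∈p∧x≢y⇒x∈p-y (J′⊆J j∈J′) (λ { ≡.refl → k∉J′ j∈J′ })

    admissible⇒Nonempty : ∀ {L J w} → Admissible L J w → Nonempty L
    admissible⇒Nonempty {L} {J} adm with nonempty? L
    ... | yes L≢∅ = L≢∅
    ... | no  L≡∅ = contradiction (trans (T≈∑QR point) (∑-zero term≈0)) T-point≉0
      where
        open Admissible adm
        term≈0 : ∀ i → Q i point * R i point ≈ 0#
        term≈0 i with splits? J (I i)
        ... | yes split  = contradiction (i , split⇒∈L i split) L≡∅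
        ... | no unsplit = unsplit-vanish i unsplit point point-on-slice

    drop-unsplit-term : ∀ {L J w i} → Admissible L J w → ¬ Splits J (I i) → Admissible (L - i) J w
    drop-unsplit-term adm unsplit = record
      { Admissible adm
      ; split⇒∈L = λ i′ split → x∈p∧x≢y⇒x∈p-y (Admissible.split⇒∈L adm i′ split) λ { ≡.refl → unsplit split }
      }

    admissible-bound : ∀ {L J w} → Acc _⊂_ L → Admissible L J w → ¬ ¬ (∣ J ∣ ℕ.+ ∣ J ∣ ≤ 2 ^ ∣ L ∣)
    admissible-bound {L} {J} (acc smaller) adm with admissible⇒Nonempty adm
    ... | i₀ , i₀∈L with larger-unsplit-part J (I i₀)
    ...   | J′ , J′⊆J , J′-unsplit , ∣J∣≤2∣J′∣ =
      subst (λ s → ¬ ¬ (∣ J ∣ ℕ.+ ∣ J ∣ ≤ 2 ^ s)) (≡.sym (x∈p⇒∣p∣≡suc∣p-x∣ i₀∈L))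
            (¬¬-map (doubling-bound {a = ∣ J′ ∣} {∣ L - i₀ ∣} ∣J∣≤2∣J′∣) half-bound)
      where
        half-bound : ¬ ¬ (∣ J′ ∣ ℕ.+ ∣ J′ ∣ ≤ 2 ^ ∣ L - i₀ ∣)
        half-bound with ∣ L ∣ ≤? ∣ J′ ∣
        ... | yes ∣L∣≤∣J′∣ = remove-rows (⊂-wellFounded J) adm J′⊆J ∣L∣≤∣J′∣ >>= λ
          { (w′ , adm′) → admissible-bound (smaller (x∈p⇒p-x⊂p i₀∈L)) (drop-unsplit-term adm′ J′-unsplit) }
        ... | no ∣L∣≰∣J′∣ = λ ¬goal → ¬goal (≤-trans (+-mono-≤ ∣J′∣≤∣L-i₀∣ ∣J′∣≤∣L-i₀∣) (m+m≤2^m ∣ L - i₀ ∣))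
          where
            ∣J′∣≤∣L-i₀∣ : ∣ J′ ∣ ≤ ∣ L - i₀ ∣
            ∣J′∣≤∣L-i₀∣ = ≤-pred (subst (suc ∣ J′ ∣ ≤_) (x∈p⇒∣p∣≡suc∣p-x∣ i₀∈L) (≰⇒> ∣L∣≰∣J′∣))

    full-admissible : (∀ i → Nonempty (I i) × Nonempty (∁ (I i))) → ∀ {x} → ¬ T x ≈ 0# → Admissible ⊤ ⊤ x
    full-admissible proper {x} Tx≉0 = record
      { point          = x
      ; point-on-slice = λ j j∉⊤ → contradiction ∈⊤ j∉⊤
      ; T-point≉0      = Tx≉0
      ; split⇒∈L       = λ _ _ → ∈⊤
      ; unsplit-vanish = λ i unsplit → contradiction (Splits-⊤ (proj₁ (proper i)) (proj₂ (proper i))) unsplit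
      }

  nonzero-alternating-prk-bound : ∀ {d N} {T : Form F d N} → MultilinearIn F ⊤ T → Alternating T →
                                  ∀ {x} → ¬ T x ≈ 0# →
                                  ∀ r → PartitionRankDecomposition F r T → d ℕ.+ d ≤ 2 ^ r
  nonzero-alternating-prk-bound {d} T-ml T-alt Tx≉0 r (I , Q , R , proper , Q-ml , R-ml , T≈∑QR) =
    decidable-stable (_ ≤? _) (subst₂ (λ m s → ¬ ¬ (m ℕ.+ m ≤ 2 ^ s)) (∣⊤∣≡n d) (∣⊤∣≡n r)
      (admissible-bound T-ml T-alt Q-ml R-ml T≈∑QR (⊂-wellFounded ⊤)
        (full-admissible T-ml T-alt Q-ml R-ml T≈∑QR proper Tx≉0)))

-- ℕ's _+_ enters the top-level scope only here: above, it would clash with the field's _+_.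
open import Data.Nat using (ℕ; _≤_; _+_)
open import Data.Nat.Logarithm using (⌈log₂_⌉)

theorem3p2 : ∀ {c ℓ : Level} (F : Field c ℓ) (n : ℕ) → 2 ≤ n →
    PrkAtLeast F (⌈log₂ n ⌉ + 1) (detForm F n)
theorem3p2 F n@(suc _) _ r decomposition =
  ⌈log₂⌉-bound n r
    (nonzero-alternating-prk-bound (det-multilinear n) (det-alternating n) {δ} det-δ≉0 r decomposition)
  where
    open FieldAlgebra F
    open Determinant F
    open PartitionRankOfAlternatingForms F
    det-δ≉0 : ¬ det F n δ ≈ 0#
    det-δ≉0 det≈0 = 0≉1 (trans (sym det≈0) (det-identity n))
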